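{- Let $D=(E,\mathcal{F})$ be a normal delta-matroid and $e_1,e_2\in E$ distinct elements such that $\{e_1,e_2\}\in\mathcal{F}$ and \[ D\setminus e_2=(\{e_1\},\{\emptyset\})\oplus \big(D\setminus\{e_1,e_2\}\big). \] Then \[ T_D(z)=T_{D\setminus e_1}(z)+2z^2\,T_{D\setminus\{e_1,e_2\}}(z). \]
   Context: A delta-matroid is $D=(E,\mathcal{F})$ with $\mathcal{F}$ a nonempty family of subsets of the finite set $E$ satisfying: for all $X,Y\in\mathcal{F}$ and $u\in X\triangle Y$ there is $v\in X\triangle Y$ with $X\triangle\{u,v\}\in\mathcal{F}$. It is normal if $\emptyset\in\mathcal{F}$. Deletion: if $e$ is not in every feasible set, $D\setminus e=(E\setminus e,\{F\in\mathcal{F}:e\notin F\})$; otherwise $D\setminus e=(E\setminus e,\{F\setminus e:F\in\mathcal{F}\})$; $D\setminus\{e_1,e_2\}$ deletes both (order irrelevant). Direct sum of delta-matroids on disjoint ground sets: $D_1\oplus D_2=(E_1\sqcup E_2,\{F_1\sqcup F_2:F_i\in\mathcal{F}_i\})$. Twist $D*A=(E,\{X\triangle A:X\in\mathcal{F}\})$, width $w(D)=\max_{F\in\mathcal{F}}|F|-\min_{F\in\mathcal{F}}|F|$, twist polynomial $T_D(z)=\sum_{A\subseteq E}z^{w(D*A)}$. -}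

module Defs where

open import Data.Nat using (ℕ; zero; suc; _+_; _*_; _∸_; _⊔_; _⊓_; _≤ᵇ_; _≡ᵇ_)
open import Data.Bool using (Bool; true; false; not; _∧_; _∨_; _xor_; if_then_else_)
open import Data.Fin using (Fin; punchOut)
open import Data.Fin.Subset using (Subset; ⊥; ⁅_⁆; _∪_; _∈_; ∣_∣)
open import Data.Vec using (Vec; []; _∷_; zipWith; insertAt; removeAt; lookup)
open import Data.List using (List; []; _∷_; map; _++_; foldr; filterᵇ; length)
open import Data.Product using (Σ; _×_; _,_)
open import Relation.Binary.PropositionalEquality using (_≡_; _≢_)
open import Function using (_∘_)

-- Ground set E = Fin n; subsets of E are Data.Fin.Subset n.
-- A set system on Fin n is a Boolean-valued membership predicate:
-- X is feasible iff F X ≡ true.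
Family : ℕ → Set
Family n = Subset n → Bool

allSubsets : (n : ℕ) → List (Subset n)
allSubsets zero = [] ∷ []
allSubsets (suc n) = map (true ∷_) (allSubsets n) ++ map (false ∷_) (allSubsets n)

_△_ : {n : ℕ} → Subset n → Subset n → Subset n
X △ Y = zipWith _xor_ X Y

IsDeltaMatroid : {n : ℕ} → Family n → Set
IsDeltaMatroid {n} F =
  Σ (Subset n) (λ X → F X ≡ true) ×
  ((X Y : Subset n) → F X ≡ true → F Y ≡ true → (u : Fin n) → u ∈ (X △ Y) →
     Σ (Fin n) (λ v → (v ∈ (X △ Y)) × (F (X △ (⁅ u ⁆ ∪ ⁅ v ⁆)) ≡ true)))

IsNormal : {n : ℕ} → Family n → Set
IsNormal F = F ⊥ ≡ true

inEveryFeasible : {n : ℕ} → Family n → Fin n → Bool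
inEveryFeasible {n} F e = foldr (λ X b → (not (F X) ∨ lookup X e) ∧ b) true (allSubsets n)

-- deletion D \ e ; ground set Fin (suc m) \ {e} identified with Fin m
-- via Data.Vec.insertAt/removeAt (order-preserving relabelling).
delete : {m : ℕ} → Family (suc m) → Fin (suc m) → Family m
delete F e X =
  if inEveryFeasible F e then F (insertAt X e true) else F (insertAt X e false)

-- D \ {e₁, e₂}: delete e₂, then delete (the image of) e₁.
delete₂ : {m : ℕ} → Family (suc (suc m)) → (e₁ e₂ : Fin (suc (suc m))) → e₂ ≢ e₁ → Family m
delete₂ F e₁ e₂ ne = delete (delete F e₂) (punchOut ne)

onlyEmpty : Family 1
onlyEmpty (b ∷ []) = not b

-- direct sum D₁ ⊕ D₂ where D₁ lives on a one-element ground set placed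
-- at position i of Fin (suc m), and D₂ lives on the remaining positions.
⊕At : {m : ℕ} → Family 1 → Fin (suc m) → Family m → Family (suc m)
⊕At F₁ i F₂ X = F₁ (lookup X i ∷ []) ∧ F₂ (removeAt X i)

twist : {n : ℕ} → Family n → Subset n → Family n
twist F A X = F (X △ A)

-- width: max size minus min size of feasible sets
-- (defaults only matter for the empty family, which is excluded)
sizes : {n : ℕ} → Family n → List ℕ
sizes {n} F = map ∣_∣ (filterᵇ F (allSubsets n))

width : {n : ℕ} → Family n → ℕ
width {n} F = foldr _⊔_ 0 (sizes F) ∸ foldr _⊓_ n (sizes F)

-- polynomials in z with ℕ coefficients, as coefficient functions
Poly : Set
Poly = ℕ → ℕ

_≈P_ : Poly → Poly → Set
p ≈P q = (k : ℕ) → p k ≡ q k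

_+P_ : Poly → Poly → Poly
(p +P q) k = p k + q k

-- c · z^d · p
monoMul : ℕ → ℕ → Poly → Poly
monoMul c d p k = if d ≤ᵇ k then c * p (k ∸ d) else 0

-- twist polynomial T_D(z) = Σ_A z^{w(D*A)}; coefficient of z^k
-- is the number of A ⊆ E with w(D*A) = k
twistPoly : {n : ℕ} → Family n → Poly
twistPoly {n} F k = length (filterᵇ (λ A → width (twist F A) ≡ᵇ k) (allSubsets n))

-- Write a subset of E as (Y, a, b), where a and b record membership of e₁ and e₂ and Y is
-- the rest. The splitting hypothesis says that no feasible set contains e₁ but not e₂.
-- Exchanging with ∅ and with {e₁, e₂} then shows that (Y, 1, 1) is feasible iff (Y, 0, 0)
-- is, i.e. iff Y is feasible in D \ {e₁, e₂}, and that every feasible (Y, 0, 1) is one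
-- exchange away from a feasible (Y △ K, 0, 0) with |K| ≤ 1.
-- Now twist by A = (A', c, d). If c ≠ d, the feasible sizes of D * A are those of
-- (D \ e₁) * (A', d) shifted by c, so the widths agree. If c = d, the least size is attained
-- at some (Y, c, c), the largest at some (Y, ¬c, ¬c), and the sets (Y, 0, 1) lie in between,
-- so w(D * A) = 2 + w((D \ {e₁, e₂}) * A'). Summing over the four choices of (c, d) gives
-- the recurrence.
module Submission where

open import Defs
open import Data.Nat using (ℕ; zero; suc; _+_; _∸_; _⊔_; _⊓_; _≡ᵇ_; _≤_; z≤n; s≤s)
open import Data.Nat.Properties
open import Data.Bool as Bool using (Bool; true; false; not; _∧_; _∨_; _xor_; T; T?; if_then_else_)
open import Data.Bool.Properties
  using (T-≡; xor-assoc; xor-comm; xor-same; xor-identityʳ; not-distribˡ-xor; ∧-zeroʳ)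
open import Data.Empty using (⊥-elim)
open import Data.Fin as Fin using (Fin; zero; suc; punchOut; punchIn)
open import Data.Fin.Properties using (punchIn-punchOut)
open import Data.Fin.Subset as Subset using (Subset; ⊥; ⁅_⁆; _∪_; ∣_∣)
open import Data.Fin.Subset.Properties using (∣p∣≤n; ∣⊥∣≡0; ∣⁅x⁆∣≡1; ∪-identityˡ)
open import Data.Vec using (Vec; []; _∷_; zipWith; insertAt; removeAt; lookup)
open import Data.Vec.Properties
  using (zipWith-identityʳ; insertAt-removeAt; insertAt-lookup; insertAt-punchIn; lookup-replicate; lookup⇒[]=)
open import Data.List using (List; []; _∷_; map; _++_; foldr; filterᵇ; length)
open import Data.List.Properties using (foldr-forcesᵇ; filter-++; length-++; filter-≐)
open import Data.List.Membership.Propositional using (_∈_)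
open import Data.List.Membership.Propositional.Properties
  using (∈-map⁺; ∈-++⁺ˡ; ∈-++⁺ʳ; ∈-map∘filter⁺; ∈-map∘filter⁻; foldr-selective)
open import Data.List.Relation.Unary.All as All using ()
open import Data.List.Relation.Unary.Any using (here; there)
open import Data.Product using (Σ; _×_; _,_; proj₁; proj₂)
open import Data.Sum using (inj₁; inj₂)
open import Function using (_∘_; Equivalence)
open import Relation.Binary.PropositionalEquality
open import Relation.Nullary using (yes; no; contradiction)
open import Algebra.Properties.CommutativeSemigroup +-commutativeSemigroup using (interchange)

private variable
  n n' : ℕ

-- Symmetric difference and sizes

△-identityʳ : (X : Subset n) → X △ ⊥ ≡ X
△-identityʳ = zipWith-identityʳ xor-identityʳ

△-⊥∪⊥ : (X : Subset n) → X △ (⊥ ∪ ⊥) ≡ X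
△-⊥∪⊥ X = trans (cong (X △_) (∪-identityˡ ⊥)) (△-identityʳ X)

△-cancelʳ : (X A : Subset n) → (X △ A) △ A ≡ X
△-cancelʳ [] [] = refl
△-cancelʳ (x ∷ X) (a ∷ A) = cong₂ _∷_ x⊕a⊕a≡x (△-cancelʳ X A)
  where
  x⊕a⊕a≡x : (x xor a) xor a ≡ x
  x⊕a⊕a≡x = trans (xor-assoc x a a) (trans (cong (x xor_) (xor-same a)) (xor-identityʳ x))

△-swapʳ : (X Y Z : Subset n) → (X △ Y) △ Z ≡ (X △ Z) △ Y
△-swapʳ [] [] [] = refl
△-swapʳ (x ∷ X) (y ∷ Y) (z ∷ Z) = cong₂ _∷_ xor-swapʳ (△-swapʳ X Y Z)
  where
  xor-swapʳ : (x xor y) xor z ≡ (x xor z) xor y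
  xor-swapʳ = trans (xor-assoc x y z) (trans (cong (x xor_) (xor-comm y z)) (sym (xor-assoc x z y)))

∣△∣≤ : (X Y : Subset n) → ∣ X △ Y ∣ ≤ ∣ X ∣ + ∣ Y ∣
∣△∣≤ [] [] = ≤-refl
∣△∣≤ (true ∷ X) (true ∷ Y) = ≤-trans (∣△∣≤ X Y) (+-mono-≤ (n≤1+n _) (n≤1+n _))
∣△∣≤ (true ∷ X) (false ∷ Y) = s≤s (∣△∣≤ X Y)
∣△∣≤ (false ∷ X) (true ∷ Y) = ≤-trans (s≤s (∣△∣≤ X Y)) (≤-reflexive (sym (+-suc _ _)))
∣△∣≤ (false ∷ X) (false ∷ Y) = ∣△∣≤ X Y

∣△∣-step : (X K A : Subset n) → ∣ K ∣ ≤ 1 → ∣ (X △ K) △ A ∣ ≤ 1 + ∣ X △ A ∣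
∣△∣-step X K A ∣K∣≤1 = begin
  ∣ (X △ K) △ A ∣    ≡⟨ cong ∣_∣ (△-swapʳ X K A) ⟩
  ∣ (X △ A) △ K ∣    ≤⟨ ∣△∣≤ (X △ A) K ⟩
  ∣ X △ A ∣ + ∣ K ∣   ≤⟨ +-monoʳ-≤ ∣ X △ A ∣ ∣K∣≤1 ⟩
  ∣ X △ A ∣ + 1      ≡⟨ +-comm ∣ X △ A ∣ 1 ⟩
  1 + ∣ X △ A ∣      ∎
  where open ≤-Reasoning

∷-cong-∣∣ : ∀ b {X Y : Subset n} → ∣ X ∣ ≡ ∣ Y ∣ → ∣ b ∷ X ∣ ≡ ∣ b ∷ Y ∣
∷-cong-∣∣ true eq = cong suc eq
∷-cong-∣∣ false eq = eq

data InsertAtView {A : Set} (i : Fin (suc n)) : Vec A (suc n) → Set where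
  insertAt-view : ∀ xs x → InsertAtView i (insertAt xs i x)

insertAtView : ∀ {A : Set} (i : Fin (suc n)) (xs : Vec A (suc n)) → InsertAtView i xs
insertAtView i xs = subst (InsertAtView i) (insertAt-removeAt xs i) (insertAt-view (removeAt xs i) (lookup xs i))

zipWith-insertAt : ∀ {A B C : Set} (f : A → B → C) (xs : Vec A n) (ys : Vec B n) (i : Fin (suc n)) x y →
  zipWith f (insertAt xs i x) (insertAt ys i y) ≡ insertAt (zipWith f xs ys) i (f x y)
zipWith-insertAt f xs ys zero x y = refl
zipWith-insertAt f (x' ∷ xs) (y' ∷ ys) (suc i) x y = cong (f x' y' ∷_) (zipWith-insertAt f xs ys i x y)

insertAt-comm : ∀ {A : Set} {i j : Fin (suc (suc n))} (i≢j : i ≢ j) (j≢i : j ≢ i) (xs : Vec A n) x y →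
  insertAt (insertAt xs (punchOut i≢j) y) i x ≡ insertAt (insertAt xs (punchOut j≢i) x) j y
insertAt-comm {i = zero} {zero} i≢j _ _ _ _ = ⊥-elim (i≢j refl)
insertAt-comm {i = zero} {suc j} _ _ _ _ _ = refl
insertAt-comm {i = suc i} {zero} _ _ _ _ _ = refl
insertAt-comm {n = zero} {i = suc zero} {suc zero} i≢j _ _ _ _ = ⊥-elim (i≢j refl)
insertAt-comm {n = suc n} {i = suc i} {suc j} i≢j j≢i (z ∷ xs) x y =
  cong (z ∷_) (insertAt-comm (i≢j ∘ cong suc) (j≢i ∘ cong suc) xs x y)

∣insertAt∣ : (X : Subset n) (i : Fin (suc n)) (b : Bool) → ∣ insertAt X i b ∣ ≡ ∣ b ∷ X ∣
∣insertAt∣ X zero b = refl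
∣insertAt∣ (x ∷ X) (suc i) b = trans (∷-cong-∣∣ x {insertAt X i b} {b ∷ X} (∣insertAt∣ X i b)) (swap x b)
  where
  swap : ∀ x b → ∣ x ∷ b ∷ X ∣ ≡ ∣ b ∷ x ∷ X ∣
  swap true true = refl
  swap true false = refl
  swap false true = refl
  swap false false = refl

∣insertAt-△∣ : (X A : Subset n) (i : Fin (suc n)) (b d : Bool) →
  ∣ insertAt X i b △ insertAt A i d ∣ ≡ ∣ (b xor d) ∷ (X △ A) ∣
∣insertAt-△∣ X A i b d = trans (cong ∣_∣ (zipWith-insertAt _xor_ X A i b d)) (∣insertAt∣ _ i _)

insertAt-⊥ : (i : Fin (suc n)) → insertAt ⊥ i false ≡ ⊥
insertAt-⊥ zero = refl
insertAt-⊥ {suc n} (suc i) = cong (false ∷_) (insertAt-⊥ i)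

⁅⁆-insertAt : (i : Fin (suc n)) → ⁅ i ⁆ ≡ insertAt ⊥ i true
⁅⁆-insertAt zero = refl
⁅⁆-insertAt {suc n} (suc i) = cong (false ∷_) (⁅⁆-insertAt i)

⁅punchIn⁆ : (i : Fin (suc n)) (j : Fin n) → ⁅ punchIn i j ⁆ ≡ insertAt ⁅ j ⁆ i false
⁅punchIn⁆ zero j = refl
⁅punchIn⁆ (suc i) zero = cong (true ∷_) (sym (insertAt-⊥ i))
⁅punchIn⁆ (suc i) (suc j) = cong (false ∷_) (⁅punchIn⁆ i j)

-- Counting subsets

∈-allSubsets : (X : Subset n) → X ∈ allSubsets n
∈-allSubsets [] = here refl
∈-allSubsets (true ∷ X) = ∈-++⁺ˡ (∈-map⁺ (true ∷_) (∈-allSubsets X))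
∈-allSubsets (false ∷ X) = ∈-++⁺ʳ _ (∈-map⁺ (false ∷_) (∈-allSubsets X))

count : (n : ℕ) → (Subset n → Bool) → ℕ
count n P = length (filterᵇ P (allSubsets n))

count-cong : {P Q : Subset n → Bool} → (∀ X → P X ≡ Q X) → count n P ≡ count n Q
count-cong {n} {P} {Q} P≗Q = cong length
  (filter-≐ (T? ∘ P) (T? ∘ Q) ((λ {X} → subst T (P≗Q X)) , (λ {X} → subst T (sym (P≗Q X)))) (allSubsets n))

count-false : count n (λ _ → false) ≡ 0
count-false {n} = go (allSubsets n)
  where
  go : ∀ {A : Set} (xs : List A) → length (filterᵇ (λ _ → false) xs) ≡ 0
  go [] = refl
  go (_ ∷ xs) = go xs

length-filterᵇ-map : ∀ {A B : Set} (P : B → Bool) (f : A → B) (xs : List A) →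
  length (filterᵇ P (map f xs)) ≡ length (filterᵇ (P ∘ f) xs)
length-filterᵇ-map P f [] = refl
length-filterᵇ-map P f (x ∷ xs) with P (f x)
... | true = cong suc (length-filterᵇ-map P f xs)
... | false = length-filterᵇ-map P f xs

count-∷ : (P : Subset (suc n) → Bool) →
  count (suc n) P ≡ count n (λ X → P (true ∷ X)) + count n (λ X → P (false ∷ X))
count-∷ {n} P = begin
  length (filterᵇ P (map (true ∷_) Xs ++ map (false ∷_) Xs))
    ≡⟨ cong length (filter-++ (T? ∘ P) (map (true ∷_) Xs) _) ⟩
  length (filterᵇ P (map (true ∷_) Xs) ++ filterᵇ P (map (false ∷_) Xs))
    ≡⟨ length-++ (filterᵇ P (map (true ∷_) Xs)) ⟩
  length (filterᵇ P (map (true ∷_) Xs)) + length (filterᵇ P (map (false ∷_) Xs))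
    ≡⟨ cong₂ _+_ (length-filterᵇ-map P (true ∷_) Xs) (length-filterᵇ-map P (false ∷_) Xs) ⟩
  count n (λ X → P (true ∷ X)) + count n (λ X → P (false ∷ X)) ∎
  where
  open ≡-Reasoning
  Xs = allSubsets n

count-insertAt : (i : Fin (suc n)) (P : Subset (suc n) → Bool) →
  count (suc n) P ≡ count n (λ X → P (insertAt X i true)) + count n (λ X → P (insertAt X i false))
count-insertAt zero P = count-∷ P
count-insertAt {suc n} (suc i) P = begin
  count (suc (suc n)) P
    ≡⟨ count-∷ P ⟩
  count (suc n) (λ X → P (true ∷ X)) + count (suc n) (λ X → P (false ∷ X))
    ≡⟨ cong₂ _+_ (count-insertAt i (λ X → P (true ∷ X))) (count-insertAt i (λ X → P (false ∷ X))) ⟩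
  (N true true + N true false) + (N false true + N false false)
    ≡⟨ interchange (N true true) (N true false) (N false true) (N false false) ⟩
  (N true true + N false true) + (N true false + N false false)
    ≡⟨ cong₂ _+_ (count-∷ (λ X → P (insertAt X (suc i) true))) (count-∷ (λ X → P (insertAt X (suc i) false))) ⟨
  count (suc n) (λ X → P (insertAt X (suc i) true)) + count (suc n) (λ X → P (insertAt X (suc i) false)) ∎
  where
  open ≡-Reasoning
  N : Bool → Bool → ℕ
  N a b = count n (λ X → P (a ∷ insertAt X i b))

count-2+ : (w : Subset n → ℕ) (k : ℕ) →
  count n (λ X → (2 + w X) ≡ᵇ k) + count n (λ X → (2 + w X) ≡ᵇ k) ≡
  monoMul 2 2 (λ j → count n (λ X → w X ≡ᵇ j)) k
count-2+ {n} w zero = cong₂ _+_ (count-false {n}) (count-false {n})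
count-2+ {n} w (suc zero) = cong₂ _+_ (count-false {n}) (count-false {n})
count-2+ w (suc (suc j)) = cong (N +_) (sym (+-identityʳ N))
  where N = count _ (λ X → w X ≡ᵇ j)

-- Extreme sizes and widths

NonEmpty : Family n → Set
NonEmpty {n} G = Σ (Subset n) λ X → G X ≡ true

maxSize minSize : Family n → ℕ
maxSize G = foldr _⊔_ 0 (sizes G)
minSize {n} G = foldr _⊓_ n (sizes G)

module _ (G : Family n) where

  ∣∣∈sizes : ∀ {X} → G X ≡ true → ∣ X ∣ ∈ sizes G
  ∣∣∈sizes {X} GX = ∈-map∘filter⁺ ∣_∣ (T? ∘ G) (X , ∈-allSubsets X , refl , Equivalence.from T-≡ GX)

  ∈sizes⁻ : ∀ {k} → k ∈ sizes G → Σ (Subset n) λ X → G X ≡ true × k ≡ ∣ X ∣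
  ∈sizes⁻ k∈ with ∈-map∘filter⁻ ∣_∣ (T? ∘ G) {xs = allSubsets n} k∈
  ... | X , _ , k≡ , GX = X , Equivalence.to T-≡ GX , k≡

  ∣∣≤maxSize : ∀ {X} → G X ≡ true → ∣ X ∣ ≤ maxSize G
  ∣∣≤maxSize GX = All.lookup (foldr-forcesᵇ ⊔-bounded 0 (sizes G) ≤-refl) (∣∣∈sizes GX)
    where
    ⊔-bounded : ∀ x y → x ⊔ y ≤ maxSize G → x ≤ maxSize G × y ≤ maxSize G
    ⊔-bounded x y le = m⊔n≤o⇒m≤o x y le , m⊔n≤o⇒n≤o x y le

  minSize≤∣∣ : ∀ {X} → G X ≡ true → minSize G ≤ ∣ X ∣
  minSize≤∣∣ GX = All.lookup (foldr-forcesᵇ ⊓-bounded _ (sizes G) ≤-refl) (∣∣∈sizes GX)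
    where
    ⊓-bounded : ∀ x y → minSize G ≤ x ⊓ y → minSize G ≤ x × minSize G ≤ y
    ⊓-bounded x y le = m≤n⊓o⇒m≤n x y le , m≤n⊓o⇒m≤o x y le

  maxSize-attained : NonEmpty G → Σ (Subset n) λ X → G X ≡ true × maxSize G ≡ ∣ X ∣
  maxSize-attained (X , GX) with foldr-selective ⊔-sel 0 (sizes G)
  ... | inj₂ max∈ = ∈sizes⁻ max∈
  ... | inj₁ max≡0 = X , GX , trans max≡0 (sym (n≤0⇒n≡0 (subst (∣ X ∣ ≤_) max≡0 (∣∣≤maxSize GX))))

  minSize-attained : NonEmpty G → Σ (Subset n) λ X → G X ≡ true × minSize G ≡ ∣ X ∣
  minSize-attained (X , GX) with foldr-selective ⊓-sel n (sizes G)
  ... | inj₂ min∈ = ∈sizes⁻ min∈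
  ... | inj₁ min≡n = X , GX , ≤-antisym (minSize≤∣∣ GX) (subst (∣ X ∣ ≤_) (sym min≡n) (∣p∣≤n X))

  minSize≤maxSize : NonEmpty G → minSize G ≤ maxSize G
  minSize≤maxSize (X , GX) = ≤-trans (minSize≤∣∣ GX) (∣∣≤maxSize GX)

record Covers (R : ℕ → ℕ → Set) (G : Family n) (G' : Family n') : Set where
  field cover : ∀ X → G X ≡ true → Σ (Subset n') λ Y → G' Y ≡ true × R ∣ X ∣ ∣ Y ∣
open Covers

Covers-map : ∀ {R R' : ℕ → ℕ → Set} {G : Family n} {G' : Family n'} →
  (∀ {x y} → R x y → R' x y) → Covers R G G' → Covers R' G G'
Covers-map R⇒R' cov .cover X GX with cover cov X GX
... | Y , G'Y , r = Y , G'Y , R⇒R' r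

module _ {G : Family n} {G' : Family n'} (c d : ℕ) (G≠∅ : NonEmpty G) where

  maxSize-mono : Covers (λ x y → d + x ≤ c + y) G G' → d + maxSize G ≤ c + maxSize G'
  maxSize-mono cov with maxSize-attained G G≠∅
  ... | X , GX , max≡ with cover cov X GX
  ...   | Y , G'Y , le = begin
    d + maxSize G   ≡⟨ cong (d +_) max≡ ⟩
    d + ∣ X ∣        ≤⟨ le ⟩
    c + ∣ Y ∣        ≤⟨ +-monoʳ-≤ c (∣∣≤maxSize G' G'Y) ⟩
    c + maxSize G'  ∎
    where open ≤-Reasoning

  minSize-mono : Covers (λ x y → c + y ≤ d + x) G G' → c + minSize G' ≤ d + minSize G
  minSize-mono cov with minSize-attained G G≠∅
  ... | X , GX , min≡ with cover cov X GX
  ...   | Y , G'Y , le = begin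
    c + minSize G'  ≤⟨ +-monoʳ-≤ c (minSize≤∣∣ G' G'Y) ⟩
    c + ∣ Y ∣        ≤⟨ le ⟩
    d + ∣ X ∣        ≡⟨ cong (d +_) min≡ ⟨
    d + minSize G   ∎
    where open ≤-Reasoning

module _ {G : Family n} {G' : Family n'} (k : ℕ) (G≠∅ : NonEmpty G) (G'≠∅ : NonEmpty G') where

  width-shift : Covers (λ x y → x ≡ k + y) G G' → Covers (λ y x → x ≡ k + y) G' G →
    width G ≡ width G'
  width-shift cov cov' = begin
    maxSize G ∸ minSize G                 ≡⟨ cong₂ _∸_ max≡ min≡ ⟩
    (k + maxSize G') ∸ (k + minSize G')   ≡⟨ [m+n]∸[m+o]≡n∸o k _ _ ⟩
    maxSize G' ∸ minSize G'               ∎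
    where
    open ≡-Reasoning
    max≡ : maxSize G ≡ k + maxSize G'
    max≡ = ≤-antisym (maxSize-mono k 0 G≠∅ (Covers-map ≤-reflexive cov))
                     (maxSize-mono 0 k G'≠∅ (Covers-map (≤-reflexive ∘ sym) cov'))
    min≡ : minSize G ≡ k + minSize G'
    min≡ = ≤-antisym (minSize-mono 0 k G'≠∅ (Covers-map ≤-reflexive cov'))
                     (minSize-mono k 0 G≠∅ (Covers-map (≤-reflexive ∘ sym) cov))

  width-sandwich : Covers (λ x y → x ≤ k + y) G G' → Covers (λ x y → y ≤ x) G G' →
    Covers (λ y x → x ≡ k + y) G' G → Covers (λ y x → x ≡ y) G' G →
    width G ≡ k + width G'
  width-sandwich below above top bottom = begin
    maxSize G ∸ minSize G              ≡⟨ cong₂ _∸_ max≡ min≡ ⟩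
    (k + maxSize G') ∸ minSize G'      ≡⟨ +-∸-assoc k (minSize≤maxSize G' G'≠∅) ⟩
    k + (maxSize G' ∸ minSize G')      ∎
    where
    open ≡-Reasoning
    max≡ : maxSize G ≡ k + maxSize G'
    max≡ = ≤-antisym (maxSize-mono k 0 G≠∅ below)
                     (maxSize-mono 0 k G'≠∅ (Covers-map (≤-reflexive ∘ sym) top))
    min≡ : minSize G ≡ minSize G'
    min≡ = ≤-antisym (minSize-mono 0 0 G'≠∅ (Covers-map ≤-reflexive bottom))
                     (minSize-mono 0 0 G≠∅ above)

twist-nonEmpty : (F : Family n) (A : Subset n) → NonEmpty F → NonEmpty (twist F A)
twist-nonEmpty F A (X , FX) = X △ A , trans (cong F (△-cancelʳ X A)) FX

twist-covers : ∀ {R : ℕ → ℕ → Set} (F : Family n) (A : Subset n) (F' : Family n') (A' : Subset n') →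
  (∀ Z → F Z ≡ true → Σ (Subset n') λ Z' → F' Z' ≡ true × R ∣ Z △ A ∣ ∣ Z' △ A' ∣) →
  Covers R (twist F A) (twist F' A')
twist-covers {R = R} F A F' A' cov .cover X FXA with cov (X △ A) FXA
... | Z' , F'Z' , r = Z' △ A' , trans (cong F' (△-cancelʳ Z' A')) F'Z' ,
                      subst (λ W → R ∣ W ∣ ∣ Z' △ A' ∣) (△-cancelʳ X A) r

-- Deletion in normal families

inEveryFeasible-normal : (F : Family n) → IsNormal F → (e : Fin n) → inEveryFeasible F e ≡ false
inEveryFeasible-normal {n} F F⊥ e = go (allSubsets n) (∈-allSubsets ⊥)
  where
  go : ∀ Xs → ⊥ ∈ Xs → foldr (λ X b → (not (F X) ∨ lookup X e) ∧ b) true Xs ≡ false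
  go (_ ∷ Xs) (here refl) rewrite F⊥ | lookup-replicate e false = refl
  go (_ ∷ Xs) (there ⊥∈Xs) rewrite go Xs ⊥∈Xs = ∧-zeroʳ _

delete-normal : (F : Family (suc n)) → IsNormal F → ∀ e X → delete F e X ≡ F (insertAt X e false)
delete-normal F F⊥ e X rewrite inEveryFeasible-normal F F⊥ e = refl

delete-isNormal : (F : Family (suc n)) → IsNormal F → ∀ e → IsNormal (delete F e)
delete-isNormal F F⊥ e = trans (delete-normal F F⊥ e ⊥) (trans (cong F (insertAt-⊥ e)) F⊥)

-- Coordinates relative to two distinct elements

module Coordinates {m : ℕ} {e₁ e₂ : Fin (suc (suc m))} (e₂≢e₁ : e₂ ≢ e₁) where

  i₁ : Fin (suc m)
  i₁ = punchOut e₂≢e₁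

  ins2 : Subset m → Bool → Bool → Subset (suc (suc m))
  ins2 Y a b = insertAt (insertAt Y i₁ a) e₂ b

  data Ins2View : Subset (suc (suc m)) → Set where
    ins2-view : ∀ Y a b → Ins2View (ins2 Y a b)

  ins2View : ∀ Z → Ins2View Z
  ins2View Z with insertAtView e₂ Z
  ... | insertAt-view V b with insertAtView i₁ V
  ...   | insertAt-view Y a = ins2-view Y a b

  count-ins2 : (P : Subset (suc (suc m)) → Bool) → count (suc (suc m)) P ≡
    (count m (λ A → P (ins2 A true true)) + count m (λ A → P (ins2 A false true))) +
    (count m (λ A → P (ins2 A true false)) + count m (λ A → P (ins2 A false false)))
  count-ins2 P = trans (count-insertAt e₂ P) (cong₂ _+_ (count-insertAt i₁ _) (count-insertAt i₁ _))

  ins2-zipWith : (f : Bool → Bool → Bool) (X Y : Subset m) (a b c d : Bool) →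
    zipWith f (ins2 X a b) (ins2 Y c d) ≡ ins2 (zipWith f X Y) (f a c) (f b d)
  ins2-zipWith f X Y a b c d =
    trans (zipWith-insertAt f _ _ e₂ b d) (cong (λ V → insertAt V e₂ (f b d)) (zipWith-insertAt f X Y i₁ a c))

  ∣ins2-△∣ : (Y A : Subset m) (a b c d : Bool) →
    ∣ ins2 Y a b △ ins2 A c d ∣ ≡ ∣ (b xor d) ∷ (a xor c) ∷ (Y △ A) ∣
  ∣ins2-△∣ Y A a b c d = begin
    ∣ ins2 Y a b △ ins2 A c d ∣                        ≡⟨ cong ∣_∣ (ins2-zipWith _xor_ Y A a b c d) ⟩
    ∣ insertAt (insertAt (Y △ A) i₁ (a xor c)) e₂ (b xor d) ∣ ≡⟨ ∣insertAt∣ _ e₂ (b xor d) ⟩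
    ∣ (b xor d) ∷ insertAt (Y △ A) i₁ (a xor c) ∣      ≡⟨ ∷-cong-∣∣ (b xor d) {insertAt (Y △ A) i₁ (a xor c)} {(a xor c) ∷ (Y △ A)} (∣insertAt∣ (Y △ A) i₁ (a xor c)) ⟩
    ∣ (b xor d) ∷ (a xor c) ∷ (Y △ A) ∣                ∎
    where open ≡-Reasoning

  lookup-e₁ : (Y : Subset m) (a b : Bool) → lookup (ins2 Y a b) e₁ ≡ a
  lookup-e₁ Y a b = begin
    lookup (ins2 Y a b) e₁              ≡⟨ cong (lookup (ins2 Y a b)) (punchIn-punchOut e₂≢e₁) ⟨
    lookup (ins2 Y a b) (punchIn e₂ i₁) ≡⟨ insertAt-punchIn _ e₂ b i₁ ⟩
    lookup (insertAt Y i₁ a) i₁         ≡⟨ insertAt-lookup Y i₁ a ⟩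
    a                                   ∎
    where open ≡-Reasoning

  e₁∈△ : ∀ {Y Y' a b a' b'} → a xor a' ≡ true → e₁ Subset.∈ (ins2 Y a b △ ins2 Y' a' b')
  e₁∈△ {Y} {Y'} {a} {b} {a'} {b'} a≢a' = lookup⇒[]= e₁ _
    (trans (cong (λ W → lookup W e₁) (ins2-zipWith _xor_ Y Y' a b a' b')) (trans (lookup-e₁ _ _ _) a≢a'))

  e₂∈△ : ∀ {Y Y' a b a' b'} → b xor b' ≡ true → e₂ Subset.∈ (ins2 Y a b △ ins2 Y' a' b')
  e₂∈△ {Y} {Y'} {a} {b} {a'} {b'} b≢b' = lookup⇒[]= e₂ _
    (trans (cong (λ W → lookup W e₂) (ins2-zipWith _xor_ Y Y' a b a' b')) (trans (insertAt-lookup _ e₂ _) b≢b'))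

  ⊥-coords : ⊥ ≡ ins2 ⊥ false false
  ⊥-coords = sym (trans (cong (λ V → insertAt V e₂ false) (insertAt-⊥ i₁)) (insertAt-⊥ e₂))

  pos : Fin m → Fin (suc (suc m))
  pos k = punchIn e₂ (punchIn i₁ k)

  data Position : Fin (suc (suc m)) → Set where
    at-e₁ : Position e₁
    at-e₂ : Position e₂
    at : (k : Fin m) → Position (pos k)

  position : ∀ v → Position v
  position v with v Fin.≟ e₂
  ... | yes refl = at-e₂
  ... | no v≢e₂ with punchOut (v≢e₂ ∘ sym) Fin.≟ i₁
  ...   | yes eq = subst Position
                     (trans (sym (punchIn-punchOut e₂≢e₁)) (trans (cong (punchIn e₂) (sym eq)) (punchIn-punchOut _)))
                     at-e₁
  ...   | no ≢i₁ = subst Position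
                     (trans (cong (punchIn e₂) (punchIn-punchOut (≢i₁ ∘ sym))) (punchIn-punchOut (v≢e₂ ∘ sym)))
                     (at (punchOut (≢i₁ ∘ sym)))

  restOf : ∀ {v} → Position v → Subset m
  restOf (at k) = ⁅ k ⁆
  restOf _ = ⊥

  isE₁ isE₂ : ∀ {v} → Position v → Bool
  isE₁ at-e₁ = true
  isE₁ _ = false
  isE₂ at-e₂ = true
  isE₂ _ = false

  ⁅⁆-coords : ∀ {v} (p : Position v) → ⁅ v ⁆ ≡ ins2 (restOf p) (isE₁ p) (isE₂ p)
  ⁅⁆-coords at-e₁ = begin
    ⁅ e₁ ⁆                       ≡⟨ cong ⁅_⁆ (punchIn-punchOut e₂≢e₁) ⟨
    ⁅ punchIn e₂ i₁ ⁆            ≡⟨ ⁅punchIn⁆ e₂ i₁ ⟩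
    insertAt ⁅ i₁ ⁆ e₂ false     ≡⟨ cong (λ V → insertAt V e₂ false) (⁅⁆-insertAt i₁) ⟩
    ins2 ⊥ true false            ∎
    where open ≡-Reasoning
  ⁅⁆-coords at-e₂ = trans (⁅⁆-insertAt e₂) (cong (λ V → insertAt V e₂ true) (sym (insertAt-⊥ i₁)))
  ⁅⁆-coords (at k) = trans (⁅punchIn⁆ e₂ _) (cong (λ V → insertAt V e₂ false) (⁅punchIn⁆ i₁ k))

  pair-coords : ∀ {u v} (p : Position u) (q : Position v) (Y : Subset m) (a b : Bool) →
    ins2 Y a b △ (⁅ u ⁆ ∪ ⁅ v ⁆) ≡
    ins2 (Y △ (restOf p ∪ restOf q)) (a xor (isE₁ p ∨ isE₁ q)) (b xor (isE₂ p ∨ isE₂ q))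
  pair-coords p q Y a b = begin
    ins2 Y a b △ (⁅ _ ⁆ ∪ ⁅ _ ⁆)
      ≡⟨ cong₂ (λ U V → ins2 Y a b △ (U ∪ V)) (⁅⁆-coords p) (⁅⁆-coords q) ⟩
    ins2 Y a b △ (ins2 (restOf p) (isE₁ p) (isE₂ p) ∪ ins2 (restOf q) (isE₁ q) (isE₂ q))
      ≡⟨ cong (ins2 Y a b △_) (ins2-zipWith _∨_ _ _ _ _ _ _) ⟩
    ins2 Y a b △ ins2 (restOf p ∪ restOf q) (isE₁ p ∨ isE₁ q) (isE₂ p ∨ isE₂ q)
      ≡⟨ ins2-zipWith _xor_ _ _ _ _ _ _ ⟩
    ins2 (Y △ (restOf p ∪ restOf q)) (a xor (isE₁ p ∨ isE₁ q)) (b xor (isE₂ p ∨ isE₂ q)) ∎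
    where open ≡-Reasoning

  ∣⊥∪restOf∣≤1 : ∀ {v} (q : Position v) → ∣ ⊥ ∪ restOf q ∣ ≤ 1
  ∣⊥∪restOf∣≤1 q = subst (λ K → ∣ K ∣ ≤ 1) (sym (∪-identityˡ (restOf q))) (∣restOf∣≤1 q)
    where
    ∣restOf∣≤1 : ∀ {v} (q : Position v) → ∣ restOf q ∣ ≤ 1
    ∣restOf∣≤1 at-e₁ = subst (_≤ 1) (sym (∣⊥∣≡0 m)) z≤n
    ∣restOf∣≤1 at-e₂ = subst (_≤ 1) (sym (∣⊥∣≡0 m)) z≤n
    ∣restOf∣≤1 (at k) = ≤-reflexive (∣⁅x⁆∣≡1 k)

module SplitPair {m : ℕ} (F : Family (suc (suc m))) (dm : IsDeltaMatroid F) (F⊥ : IsNormal F)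
  {e₁ e₂ : Fin (suc (suc m))} (e₂≢e₁ : e₂ ≢ e₁) (pair∈F : F (⁅ e₁ ⁆ ∪ ⁅ e₂ ⁆) ≡ true)
  (splits : ∀ X → delete F e₂ X ≡ ⊕At onlyEmpty (punchOut e₂≢e₁) (delete₂ F e₁ e₂ e₂≢e₁) X) where

  open Coordinates e₂≢e₁ public

  f : Subset m → Bool → Bool → Bool
  f Y a b = F (ins2 Y a b)

  i₂ : Fin (suc m)
  i₂ = punchOut (e₂≢e₁ ∘ sym)

  DF : Family (suc m)
  DF = delete F e₁

  D2 : Family m
  D2 = delete₂ F e₁ e₂ e₂≢e₁

  F≠∅ : NonEmpty F
  F≠∅ = ⊥ , F⊥

  DF≠∅ : NonEmpty DF
  DF≠∅ = ⊥ , delete-isNormal F F⊥ e₁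

  D2≠∅ : NonEmpty D2
  D2≠∅ = ⊥ , delete-isNormal (delete F e₂) (delete-isNormal F F⊥ e₂) i₁

  DF-coords : ∀ Y b → DF (insertAt Y i₂ b) ≡ f Y false b
  DF-coords Y b = trans (delete-normal F F⊥ e₁ _) (cong F (insertAt-comm (e₂≢e₁ ∘ sym) e₂≢e₁ Y false b))

  D2-coords : ∀ Y → D2 Y ≡ f Y false false
  D2-coords Y = trans (delete-normal (delete F e₂) (delete-isNormal F F⊥ e₂) i₁ Y) (delete-normal F F⊥ e₂ _)

  -- The splitting hypothesis is used only through this consequence.
  e₁∈⇒e₂∈ : ∀ {Y a b} → f Y a b ≡ true → a Bool.≤ b
  e₁∈⇒e₂∈ {Y} {false} {false} _ = Bool.b≤b
  e₁∈⇒e₂∈ {Y} {false} {true} _ = Bool.f≤t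
  e₁∈⇒e₂∈ {Y} {true} {true} _ = Bool.b≤b
  e₁∈⇒e₂∈ {Y} {true} {false} fY = contradiction (trans (sym fY) f10≡false) λ ()
    where
    open ≡-Reasoning
    f10≡false : f Y true false ≡ false
    f10≡false = begin
      f Y true false                            ≡⟨ delete-normal F F⊥ e₂ (insertAt Y i₁ true) ⟨
      delete F e₂ (insertAt Y i₁ true)          ≡⟨ splits _ ⟩
      onlyEmpty (lookup (insertAt Y i₁ true) i₁ ∷ []) ∧ D2 (removeAt (insertAt Y i₁ true) i₁)
        ≡⟨ cong (λ b → onlyEmpty (b ∷ []) ∧ D2 (removeAt (insertAt Y i₁ true) i₁)) (insertAt-lookup Y i₁ true) ⟩
      false                                     ∎

  f⊥00 : f ⊥ false false ≡ true
  f⊥00 = trans (cong F (sym ⊥-coords)) F⊥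

  f⊥11 : f ⊥ true true ≡ true
  f⊥11 = trans (cong F (sym pair≡)) pair∈F
    where
    pair≡ : ⁅ e₁ ⁆ ∪ ⁅ e₂ ⁆ ≡ ins2 ⊥ true true
    pair≡ = trans (cong₂ _∪_ (⁅⁆-coords at-e₁) (⁅⁆-coords at-e₂))
      (trans (ins2-zipWith _∨_ ⊥ ⊥ true false false true) (cong (λ V → ins2 V true true) (∪-identityˡ ⊥)))

  exchange : ∀ {Y a b Y' a' b' u} → f Y a b ≡ true → f Y' a' b' ≡ true → (p : Position u) →
    u Subset.∈ (ins2 Y a b △ ins2 Y' a' b') →
    Σ (Fin (suc (suc m))) λ v → Σ (Position v) λ q →
      f (Y △ (restOf p ∪ restOf q)) (a xor (isE₁ p ∨ isE₁ q)) (b xor (isE₂ p ∨ isE₂ q)) ≡ true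
  exchange {Y} {a} {b} fY fY' p u∈ with proj₂ dm _ _ fY fY' _ u∈
  ... | v , _ , F[X△uv] = v , position v , trans (cong F (sym (pair-coords p (position v) Y a b))) F[X△uv]

  f11⇒f00 : ∀ {Y} → f Y true true ≡ true → f Y false false ≡ true
  f11⇒f00 {Y} fY with exchange fY f⊥00 at-e₂ (e₂∈△ refl)
  ... | _ , at-e₁ , fY' = subst (λ W → f W false false ≡ true) (△-⊥∪⊥ Y) fY'
  ... | _ , at-e₂ , fY' with () ← e₁∈⇒e₂∈ fY'
  ... | _ , at k , fY' with () ← e₁∈⇒e₂∈ fY'

  f00⇒f11 : ∀ {Y} → f Y false false ≡ true → f Y true true ≡ true
  f00⇒f11 {Y} fY with exchange fY f⊥11 at-e₁ (e₁∈△ refl)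
  ... | _ , at-e₂ , fY' = subst (λ W → f W true true ≡ true) (△-⊥∪⊥ Y) fY'
  ... | _ , at-e₁ , fY' with () ← e₁∈⇒e₂∈ fY'
  ... | _ , at k , fY' with () ← e₁∈⇒e₂∈ fY'

  f01⇒f00-nearby : ∀ {Y} → f Y false true ≡ true →
    Σ (Subset m) λ K → ∣ K ∣ ≤ 1 × f (Y △ K) false false ≡ true
  f01⇒f00-nearby fY with exchange fY f⊥00 at-e₂ (e₂∈△ refl)
  ... | _ , q@at-e₂ , fY' = _ , ∣⊥∪restOf∣≤1 q , fY'
  ... | _ , q@(at k) , fY' = _ , ∣⊥∪restOf∣≤1 q , fY'
  ... | _ , at-e₁ , fY' with () ← e₁∈⇒e₂∈ fY'

  restrict-to-DF : ∀ {Y a b} → f Y a b ≡ true → DF (insertAt Y i₂ (a xor b)) ≡ true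
  restrict-to-DF {Y} fY = trans (DF-coords Y _) (drop (e₁∈⇒e₂∈ fY) fY)
    where
    drop : ∀ {a b} → a Bool.≤ b → f Y a b ≡ true → f Y false (a xor b) ≡ true
    drop (Bool.b≤b {false}) fY = fY
    drop (Bool.b≤b {true}) fY = f11⇒f00 fY
    drop Bool.f≤t fY = fY

  D2⇒diagonal : ∀ {Y} → D2 Y ≡ true → ∀ a → f Y a a ≡ true
  D2⇒diagonal {Y} D2Y false = trans (sym (D2-coords Y)) D2Y
  D2⇒diagonal {Y} D2Y true = f00⇒f11 (D2⇒diagonal D2Y false)

  diagonal⇒D2 : ∀ {Y a} → f Y a a ≡ true → D2 Y ≡ true
  diagonal⇒D2 {Y} {false} fY = trans (D2-coords Y) fY
  diagonal⇒D2 {Y} {true} fY = trans (D2-coords Y) (f11⇒f00 fY)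

  width-twist-off-diagonal : ∀ c A' →
    width (twist F (ins2 A' c (not c))) ≡ width (twist DF (insertAt A' i₂ (not c)))
  width-twist-off-diagonal c A' = width-shift offset (twist-nonEmpty F _ F≠∅) (twist-nonEmpty DF _ DF≠∅)
    (twist-covers F _ DF _ to-DF) (twist-covers DF _ F _ from-DF)
    where
    offset : ℕ
    offset = if c then 1 else 0

    to-DF : ∀ Z → F Z ≡ true → Σ (Subset (suc m)) λ Z' → DF Z' ≡ true ×
      ∣ Z △ ins2 A' c (not c) ∣ ≡ offset + ∣ Z' △ insertAt A' i₂ (not c) ∣
    to-DF Z FZ with ins2View Z
    ... | ins2-view Y a b = insertAt Y i₂ (a xor b) , restrict-to-DF FZ , (begin
      ∣ ins2 Y a b △ ins2 A' c (not c) ∣                         ≡⟨ ∣ins2-△∣ Y A' a b c (not c) ⟩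
      ∣ (b xor not c) ∷ (a xor c) ∷ (Y △ A') ∣                   ≡⟨ shifted (e₁∈⇒e₂∈ FZ) c (Y △ A') ⟩
      offset + ∣ ((a xor b) xor not c) ∷ (Y △ A') ∣              ≡⟨ cong (offset +_) (∣insertAt-△∣ Y A' i₂ _ _) ⟨
      offset + ∣ insertAt Y i₂ (a xor b) △ insertAt A' i₂ (not c) ∣ ∎)
      where
      open ≡-Reasoning
      shifted : ∀ {a b} → a Bool.≤ b → ∀ c (W : Subset m) →
        ∣ (b xor not c) ∷ (a xor c) ∷ W ∣ ≡ (if c then 1 else 0) + ∣ ((a xor b) xor not c) ∷ W ∣
      shifted (Bool.b≤b {false}) false W = refl
      shifted (Bool.b≤b {false}) true W = refl
      shifted (Bool.b≤b {true}) false W = refl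
      shifted (Bool.b≤b {true}) true W = refl
      shifted Bool.f≤t false W = refl
      shifted Bool.f≤t true W = refl

    from-DF : ∀ X → DF X ≡ true → Σ (Subset (suc (suc m))) λ Z → F Z ≡ true ×
      ∣ Z △ ins2 A' c (not c) ∣ ≡ offset + ∣ X △ insertAt A' i₂ (not c) ∣
    from-DF X DFX with insertAtView i₂ X
    ... | insertAt-view Y b = ins2 Y false b , trans (sym (DF-coords Y b)) DFX , (begin
      ∣ ins2 Y false b △ ins2 A' c (not c) ∣       ≡⟨ ∣ins2-△∣ Y A' false b c (not c) ⟩
      ∣ (b xor not c) ∷ c ∷ (Y △ A') ∣             ≡⟨ shifted (b xor not c) c (Y △ A') ⟩
      offset + ∣ (b xor not c) ∷ (Y △ A') ∣        ≡⟨ cong (offset +_) (∣insertAt-△∣ Y A' i₂ b (not c)) ⟨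
      offset + ∣ insertAt Y i₂ b △ insertAt A' i₂ (not c) ∣ ∎)
      where
      open ≡-Reasoning
      shifted : ∀ x c (W : Subset m) → ∣ x ∷ c ∷ W ∣ ≡ (if c then 1 else 0) + ∣ x ∷ W ∣
      shifted false false W = refl
      shifted false true W = refl
      shifted true false W = refl
      shifted true true W = refl

  width-twist-diagonal : ∀ c A' → width (twist F (ins2 A' c c)) ≡ 2 + width (twist D2 A')
  width-twist-diagonal c A' = width-sandwich 2 (twist-nonEmpty F _ F≠∅) (twist-nonEmpty D2 A' D2≠∅)
    (Covers-map proj₁ bounds) (Covers-map proj₂ bounds)
    (twist-covers D2 A' F _ (to-diagonal (not c) 2 top-size))
    (twist-covers D2 A' F _ (to-diagonal c 0 bottom-size))
    where
    A = ins2 A' c c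

    bounds : Covers (λ x y → x ≤ 2 + y × y ≤ x) (twist F A) (twist D2 A')
    bounds = twist-covers F A D2 A' to-D2
      where
      to-D2 : ∀ Z → F Z ≡ true → Σ (Subset m) λ Y' → D2 Y' ≡ true ×
        (∣ Z △ A ∣ ≤ 2 + ∣ Y' △ A' ∣ × ∣ Y' △ A' ∣ ≤ ∣ Z △ A ∣)
      to-D2 Z FZ with ins2View Z
      ... | ins2-view Y a b with e₁∈⇒e₂∈ FZ
      ...   | Bool.b≤b = Y , diagonal⇒D2 FZ ,
          subst (λ x → x ≤ 2 + ∣ Y △ A' ∣ × ∣ Y △ A' ∣ ≤ x) (sym (∣ins2-△∣ Y A' a a c c)) (double (a xor c) (Y △ A'))
        where
        double : ∀ x W → ∣ x ∷ x ∷ W ∣ ≤ 2 + ∣ W ∣ × ∣ W ∣ ≤ ∣ x ∷ x ∷ W ∣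
        double false W = m≤n+m ∣ W ∣ 2 , ≤-refl
        double true W = ≤-refl , m≤n+m ∣ W ∣ 2
      ...   | Bool.f≤t with f01⇒f00-nearby FZ
      ...     | K , ∣K∣≤1 , fYK = Y △ K , diagonal⇒D2 fYK ,
          subst (λ x → x ≤ 2 + ∣ (Y △ K) △ A' ∣ × ∣ (Y △ K) △ A' ∣ ≤ x) (sym size≡) (s≤s back , forth)
        where
        size≡ : ∣ ins2 Y false true △ A ∣ ≡ 1 + ∣ Y △ A' ∣
        size≡ = trans (∣ins2-△∣ Y A' false true c c) (one c)
          where
          one : ∀ c → ∣ not c ∷ c ∷ Y △ A' ∣ ≡ 1 + ∣ Y △ A' ∣
          one false = refl
          one true = refl
        back : ∣ Y △ A' ∣ ≤ 1 + ∣ (Y △ K) △ A' ∣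
        back = subst (λ X → ∣ X △ A' ∣ ≤ 1 + ∣ (Y △ K) △ A' ∣) (△-cancelʳ Y K) (∣△∣-step (Y △ K) K A' ∣K∣≤1)
        forth : ∣ (Y △ K) △ A' ∣ ≤ 1 + ∣ Y △ A' ∣
        forth = ∣△∣-step Y K A' ∣K∣≤1

    to-diagonal : ∀ a k → (∀ W → ∣ (a xor c) ∷ (a xor c) ∷ W ∣ ≡ k + ∣ W ∣) →
      ∀ Y → D2 Y ≡ true → Σ (Subset (suc (suc m))) λ Z → F Z ≡ true × ∣ Z △ A ∣ ≡ k + ∣ Y △ A' ∣
    to-diagonal a k size Y D2Y = ins2 Y a a , D2⇒diagonal D2Y a , trans (∣ins2-△∣ Y A' a a c c) (size (Y △ A'))

    top-size : ∀ W → ∣ (not c xor c) ∷ (not c xor c) ∷ W ∣ ≡ 2 + ∣ W ∣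
    top-size W = cong (λ x → ∣ x ∷ x ∷ W ∣) (trans (sym (not-distribˡ-xor c c)) (cong not (xor-same c)))

    bottom-size : ∀ W → ∣ (c xor c) ∷ (c xor c) ∷ W ∣ ≡ 0 + ∣ W ∣
    bottom-size W = cong (λ x → ∣ x ∷ x ∷ W ∣) (xor-same c)

proposition6p2 : {m : ℕ} (F : Family (suc (suc m))) → IsDeltaMatroid F → IsNormal F →
    (e₁ e₂ : Fin (suc (suc m))) (ne : e₂ ≢ e₁) →
    F (⁅ e₁ ⁆ ∪ ⁅ e₂ ⁆) ≡ true →
    (∀ X → delete F e₂ X ≡ ⊕At onlyEmpty (punchOut ne) (delete₂ F e₁ e₂ ne) X) →
    twistPoly F ≈P (twistPoly (delete F e₁) +P monoMul 2 2 (twistPoly (delete₂ F e₁ e₂ ne)))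
proposition6p2 {m} F dm F⊥ e₁ e₂ ne pair∈F splits k = begin
  twistPoly F k
    ≡⟨ count-ins2 (λ A → width (twist F A) ≡ᵇ k) ⟩
  (N true true + N false true) + (N true false + N false false)
    ≡⟨ cong₂ _+_ (cong₂ _+_ (diagonal-count true) (off-diagonal-count false))
                 (cong₂ _+_ (off-diagonal-count true) (diagonal-count false)) ⟩
  (G + D true) + (D false + G)
    ≡⟨ cong (_+ (D false + G)) (+-comm G (D true)) ⟩
  (D true + G) + (D false + G)
    ≡⟨ interchange (D true) G (D false) G ⟩
  (D true + D false) + (G + G)
    ≡⟨ cong₂ _+_ (count-insertAt i₂ _) (sym (count-2+ (λ A' → width (twist D2 A')) k)) ⟨
  twistPoly DF k + monoMul 2 2 (twistPoly D2) k ∎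
  where
  open ≡-Reasoning
  open SplitPair F dm F⊥ ne pair∈F splits
  N : Bool → Bool → ℕ
  N a b = count m (λ A' → width (twist F (ins2 A' a b)) ≡ᵇ k)
  D : Bool → ℕ
  D d = count m (λ A' → width (twist DF (insertAt A' i₂ d)) ≡ᵇ k)
  G : ℕ
  G = count m (λ A' → (2 + width (twist D2 A')) ≡ᵇ k)
  diagonal-count : ∀ c → N c c ≡ G
  diagonal-count c = count-cong λ A' → cong (_≡ᵇ k) (width-twist-diagonal c A')
  off-diagonal-count : ∀ c → N c (not c) ≡ D (not c)
  off-diagonal-count c = count-cong λ A' → cong (_≡ᵇ k) (width-twist-off-diagonal c A')
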